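{- Let $G$ be a graph containing no four-hole, let $n\in\mathbb{N}$, and let $X\subseteq V(G)$ be the set of all $v\in V(G)$ with $\chi(N(v))>n$. If $\chi(X)>\omega(G)$, then there exist disjoint sets $A,B\subseteq V(G)$, anticomplete to each other, with $\chi(A),\chi(B)>n/2-\omega(G)$.
   Context: All graphs are finite and simple; $\chi$, $\omega$ denote chromatic number and clique number, and $\chi(A)=\chi(G[A])$ for $A\subseteq V(G)$. $N(v)$ is the set of neighbours of $v$. A four-hole is an induced cycle of length four. Two disjoint vertex sets are anticomplete if there are no edges between them. -}

module Defs where

open import Data.Nat using (ℕ; suc)
open import Data.Fin using (Fin)
open import Data.Bool using (Bool; true; false)
open import Data.Product using (Σ; _×_; ∃)
open import Relation.Nullary using (¬_)
open import Relation.Binary.PropositionalEquality using (_≡_; _≢_)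
open import Level using (0ℓ)

record Graph (N : ℕ) : Set where
  field
    adj     : Fin N → Fin N → Bool
    sym     : ∀ u v → adj u v ≡ adj v u
    irrefl  : ∀ v → adj v v ≡ false

module _ {N : ℕ} (G : Graph N) where
  open Graph G

  Adj : Fin N → Fin N → Set
  Adj u v = adj u v ≡ true

  VSet : Set₁
  VSet = Fin N → Set

  Nbhd : Fin N → VSet
  Nbhd v u = Adj v u

  Colourable : VSet → ℕ → Set
  Colourable A k = Σ (Fin N → Fin k) λ f →
    ∀ u v → A u → A v → Adj u v → f u ≢ f v

  ChiGreater : VSet → ℕ → Set
  ChiGreater A k = ¬ Colourable A k

  HasClique : ℕ → Set
  HasClique k = Σ (Fin k → Fin N) λ f → ∀ i j → i ≢ j → Adj (f i) (f j)

  IsCliqueNumber : ℕ → Set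
  IsCliqueNumber w = HasClique w × ¬ HasClique (suc w)

  HasFourHole : Set
  HasFourHole = Σ (Fin N) λ a → Σ (Fin N) λ b → Σ (Fin N) λ c → Σ (Fin N) λ d →
    a ≢ c × b ≢ d ×
    Adj a b × Adj b c × Adj c d × Adj d a ×
    ¬ Adj a c × ¬ Adj b d

  Disjoint : VSet → VSet → Set
  Disjoint A B = ∀ v → A v → B v → Data.Empty.⊥
    where import Data.Empty

  Anticomplete : VSet → VSet → Set
  Anticomplete A B = ∀ u v → A u → B v → ¬ Adj u v

-- X cannot induce a graph without induced P₄ and C₄: in such a graph the closed
-- neighbourhoods of adjacent vertices are nested, so the vertices strictly above v in
-- this nesting order form a clique together with v, and colouring v by their number is
-- a proper colouring with at most ω colours.  Hence X contains a path x₁x₂x₃x₄ whose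
-- chords x₁x₃ and x₂x₄ are missing.  If an edge ab of it has χ(N(a) ∩ N(b)) ≤ n/2,
-- take A = N(a) ∖ N[b] and B = N(b) ∖ N[a]: an edge between them would close a
-- four-hole through a and b, and χ(A) ≥ χ(N(a)) − 1 − n/2 ≥ n/2.  Otherwise take
-- A = N(x₁) ∩ N(x₂) ∖ N(x₃) and B = N(x₃) ∩ N(x₄) ∖ N(x₂), anticomplete because of the
-- hole u x₂ x₃ v; since the common neighbours of the non-adjacent x₁, x₃ form a clique,
-- removing N(x₃) lowers χ(N(x₁) ∩ N(x₂)) > n/2 by at most ω.
module Submission where

open import Defs
open import Data.Nat using (ℕ; _*_; _+_; _<_)
open import Data.Fin using (Fin)
open import Data.Product using (Σ; _×_)
open import Relation.Nullary using (¬_)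

open import Data.Nat using (suc; _≤_; s≤s; s≤s⁻¹; ⌊_/2⌋; ⌈_/2⌉)
open import Data.Nat.Properties
  using (≤-reflexive; ≮⇒≥; ≤-trans; <-trans; <-irrefl; <-cmp; _<?_; ≰⇒>; n≤1+n; n<1+n; +-suc; +-comm; +-identityʳ;
         +-monoʳ-≤; +-monoˡ-≤; +-monoʳ-<; +-mono-≤; +-mono-<; +-cancelˡ-≤; m<m+n; ⌊n/2⌋-mono; ⌊n/2⌋≤⌈n/2⌉; ⌊n/2⌋+⌈n/2⌉≡n;
         module ≤-Reasoning)
open import Data.Fin using (zero; suc; toℕ; fromℕ<; inject≤; join; splitAt; finToFun; funToFin)
open import Data.Fin.Properties
  using (any?; all?; ¬∀⟶∃¬; toℕ-injective; fromℕ<-injective; inject≤-injective; suc-injective; splitAt-join; finToFun-funToFin)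
  renaming (_≟_ to _≟ᶠ_)
open import Data.Fin.Subset as Subset using (Subset; inside; outside; ∣_∣)
open import Data.Fin.Subset.Properties using (p⊂q⇒∣p∣<∣q∣)
open import Data.Vec using (_∷_; tabulate; here; there)
open import Data.Vec.Properties using (lookup∘tabulate; lookup⇒[]=; []=⇒lookup)
open import Data.Bool.Properties using () renaming (_≟_ to _≟ᵇ_)
open import Data.Product using (_,_; proj₁; proj₂)
open import Data.Sum using (_⊎_; inj₁; inj₂; swap; fromInj₂)
open import Data.Sum.Properties using (inj₁-injective; inj₂-injective)
open import Function using (_∘_)
open import Function.Definitions using (Injective)
open import Relation.Nullary using (Dec; yes; no; does; contradiction)
open import Relation.Nullary.Decidable using (map′; _×-dec_; _⊎-dec_; _→-dec_; ¬?; dec-true; decidable-stable)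
open import Relation.Unary using (Pred; Decidable; _⊆_; _⊆′_; _∪_; _∩_; ∁)
open import Relation.Unary.Properties using (_∪?_; _∩?_)
open import Relation.Binary using (tri<; tri≈; tri>)
open import Relation.Binary.PropositionalEquality
open import Data.Bool using (true)

subset : ∀ {n ℓ} {P : Pred (Fin n) ℓ} → Decidable P → Subset n
subset P? = tabulate (does ∘ P?)

module _ {n ℓ} {P : Pred (Fin n) ℓ} (P? : Decidable P) where

  ∈-subset⁺ : ∀ {x} → P x → x Subset.∈ subset P?
  ∈-subset⁺ {x} px = lookup⇒[]= x _ (trans (lookup∘tabulate _ x) (dec-true (P? x) px))

  ∈-subset⁻ : ∀ {x} → x Subset.∈ subset P? → P x
  ∈-subset⁻ {x} x∈ with P? x | trans (sym (lookup∘tabulate (does ∘ P?) x)) ([]=⇒lookup x∈)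
  ... | yes px | _ = px
  ... | no _   | ()

enumerate : ∀ {n} (p : Subset n) → Fin ∣ p ∣ → Fin n
enumerate (inside  ∷ p) zero    = zero
enumerate (inside  ∷ p) (suc i) = suc (enumerate p i)
enumerate (outside ∷ p) i       = suc (enumerate p i)

enumerate-∈ : ∀ {n} (p : Subset n) i → enumerate p i Subset.∈ p
enumerate-∈ (inside  ∷ p) zero    = here
enumerate-∈ (inside  ∷ p) (suc i) = there (enumerate-∈ p i)
enumerate-∈ (outside ∷ p) i       = there (enumerate-∈ p i)

enumerate-injective : ∀ {n} (p : Subset n) → Injective _≡_ _≡_ (enumerate p)
enumerate-injective (inside  ∷ p) {zero}  {zero}  _  = refl
enumerate-injective (inside  ∷ p) {suc i} {suc j} eq = cong suc (enumerate-injective p (suc-injective eq))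
enumerate-injective (outside ∷ p) eq = enumerate-injective p (suc-injective eq)

module _ {N : ℕ} (G : Graph N) where

  adj? : ∀ u v → Dec (Adj G u v)
  adj? u v = Graph.adj G u v ≟ᵇ true

  Adj-sym : ∀ {u v} → Adj G u v → Adj G v u
  Adj-sym {u} {v} uv = trans (Graph.sym G v u) uv

  Adj⇒≢ : ∀ {u v} → Adj G u v → u ≢ v
  Adj⇒≢ {u} uv refl with () ← trans (sym (Graph.irrefl G u)) uv

  Proper : VSet G → ∀ {k} → (Fin N → Fin k) → Set
  Proper A f = ∀ u v → A u → A v → Adj G u v → f u ≢ f v

  colourable? : ∀ {A : VSet G} → Decidable A → ∀ k → Dec (Colourable G A k)
  colourable? {A} A? k =
    map′ (λ (i , p) → finToFun i , p) (λ (f , p) → funToFin f , decoded-proper f p)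
         (any? (proper? ∘ finToFun))
    where
    proper? : (f : Fin N → Fin k) → Dec (Proper A f)
    proper? f = all? λ u → all? λ v → A? u →-dec (A? v →-dec (adj? u v →-dec ¬? (f u ≟ᶠ f v)))

    decoded-proper : ∀ f → Proper A f → Proper A (finToFun (funToFin f))
    decoded-proper f p u v Au Av uv same =
      p u v Au Av uv (trans (sym (finToFun-funToFin f u)) (trans same (finToFun-funToFin f v)))

  colourable-⊆ : ∀ {A B : VSet G} {k} → B ⊆ A → Colourable G A k → Colourable G B k
  colourable-⊆ B⊆A (f , f-proper) = f , λ u v Bu Bv → f-proper u v (B⊆A Bu) (B⊆A Bv)

  colourable-≤ : ∀ {A : VSet G} {k l} → k ≤ l → Colourable G A k → Colourable G A l
  colourable-≤ k≤l (f , f-proper) =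
    (λ v → inject≤ (f v) k≤l) ,
    λ u v Au Av uv same → f-proper u v Au Av uv (inject≤-injective k≤l k≤l (f u) (f v) same)

  colourable-singleton : ∀ x → Colourable G (_≡ x) 1
  colourable-singleton x = (λ _ → zero) , λ { u v refl refl xx _ → Adj⇒≢ xx refl }

  colourable-∪ : ∀ {A B : VSet G} {a b} → Decidable A →
    Colourable G A a → Colourable G B b → Colourable G (A ∪ B) (a + b)
  colourable-∪ {A} {B} {a} {b} A? (f , f-proper) (g , g-proper) = join a b ∘ side , join-proper
    where
    side : ∀ v → Fin a ⊎ Fin b
    side v with A? v
    ... | yes _ = inj₁ (f v)
    ... | no  _ = inj₂ (g v)

    side-proper : ∀ u v → (A ∪ B) u → (A ∪ B) v → Adj G u v → side u ≢ side v
    side-proper u v ABu ABv uv with A? u | A? v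
    ... | yes Au  | yes Av  = f-proper u v Au Av uv ∘ inj₁-injective
    ... | yes _   | no  _   = λ ()
    ... | no  _   | yes _   = λ ()
    ... | no  ¬Au | no  ¬Av = g-proper u v (only-B ¬Au ABu) (only-B ¬Av ABv) uv ∘ inj₂-injective
      where
      only-B : ∀ {x} → ¬ A x → (A ∪ B) x → B x
      only-B ¬Ax = fromInj₂ (λ Ax → contradiction Ax ¬Ax)

    join-proper : Proper (A ∪ B) (join a b ∘ side)
    join-proper u v ABu ABv uv same = side-proper u v ABu ABv uv
      (trans (sym (splitAt-join a b (side u))) (trans (cong (splitAt a) same) (splitAt-join a b (side v))))

  chi-subadditive : ∀ {C A B : VSet G} {m a b} → ChiGreater G C m → C ⊆ A ∪ B → Decidable A →
    Colourable G A a → Colourable G B b → m < a + b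
  chi-subadditive χC>m C⊆A∪B A? colA colB =
    ≰⇒> λ a+b≤m → χC>m (colourable-≤ a+b≤m (colourable-⊆ C⊆A∪B (colourable-∪ A? colA colB)))

  clique-size-bound : ∀ {m w} → ¬ HasClique G (suc w) → HasClique G m → m ≤ w
  clique-size-bound ¬ω (f , clique) = ≮⇒≥ λ w<m →
    ¬ω ((λ i → f (inject≤ i w<m)) , λ i j i≢j → clique _ _ (i≢j ∘ inject≤-injective w<m w<m i j))

  singleton-clique : Fin N → HasClique G 1
  singleton-clique v = (λ _ → v) , λ { zero zero 0≢0 → contradiction refl 0≢0 }

  -- A path a-b-c-d in Y without the chords ac and bd; the chord ad may be present,
  -- so this is an induced P₄ or an induced C₄ of G[Y].
  HasInducedP₄orC₄ : VSet G → Set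
  HasInducedP₄orC₄ Y = Σ (Fin N) λ a → Σ (Fin N) λ b → Σ (Fin N) λ c → Σ (Fin N) λ d →
    Y a × Y b × Y c × Y d × Adj G a b × Adj G b c × Adj G c d ×
    ¬ Adj G a c × ¬ Adj G b d × a ≢ c × b ≢ d

  hasInducedP₄orC₄? : ∀ {Y : VSet G} → Decidable Y → Dec (HasInducedP₄orC₄ Y)
  hasInducedP₄orC₄? Y? = any? λ a → any? λ b → any? λ c → any? λ d →
    Y? a ×-dec Y? b ×-dec Y? c ×-dec Y? d ×-dec adj? a b ×-dec adj? b c ×-dec adj? c d ×-dec
    ¬? (adj? a c) ×-dec ¬? (adj? b d) ×-dec ¬? (a ≟ᶠ c) ×-dec ¬? (b ≟ᶠ d)

  module TriviallyPerfect {Y : VSet G} (Y? : Decidable Y) (free : ¬ HasInducedP₄orC₄ Y) where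

    N̄ : Fin N → VSet G
    N̄ u z = Y z × (z ≡ u ⊎ Adj G z u)

    N̄? : ∀ u → Decidable (N̄ u)
    N̄? u z = Y? z ×-dec ((z ≟ᶠ u) ⊎-dec adj? z u)

    N̄⊆N̄? : ∀ u v → Dec (N̄ u ⊆′ N̄ v)
    N̄⊆N̄? u v = all? λ z → N̄? u z →-dec N̄? v z

    private-neighbour : ∀ {u v} → Adj G u v → ¬ (N̄ u ⊆′ N̄ v) →
      Σ (Fin N) λ z → Y z × Adj G z u × ¬ Adj G z v × z ≢ v
    private-neighbour {u} {v} uv N̄u⊈N̄v
      with z , ¬[N̄u⇒N̄v] ← ¬∀⟶∃¬ N _ (λ z → N̄? u z →-dec N̄? v z) N̄u⊈N̄v
      with decidable-stable (N̄? u z) (λ z∉N̄u → ¬[N̄u⇒N̄v] (λ z∈N̄u → contradiction z∈N̄u z∉N̄u))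
    ... | Yz , inj₁ refl = contradiction (λ _ → Yz , inj₂ uv) ¬[N̄u⇒N̄v]
    ... | Yz , inj₂ zu   =
      z , Yz , zu , (λ zv → ¬[N̄u⇒N̄v] λ _ → Yz , inj₂ zv) , (λ z≡v → ¬[N̄u⇒N̄v] λ _ → Yz , inj₁ z≡v)

    nested : ∀ {u v} → Y u → Y v → Adj G u v → N̄ u ⊆′ N̄ v ⊎ N̄ v ⊆′ N̄ u
    nested {u} {v} Yu Yv uv with N̄⊆N̄? u v | N̄⊆N̄? v u
    ... | yes N̄u⊆N̄v | _           = inj₁ N̄u⊆N̄v
    ... | no _       | yes N̄v⊆N̄u = inj₂ N̄v⊆N̄u
    ... | no N̄u⊈N̄v  | no N̄v⊈N̄u
      with z  , Yz  , zu  , ¬zv  , z≢v  ← private-neighbour uv N̄u⊈N̄v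
         | z′ , Yz′ , z′v , ¬z′u , z′≢u ← private-neighbour (Adj-sym uv) N̄v⊈N̄u =
      contradiction (z , u , v , z′ , Yz , Yu , Yv , Yz′ , zu , uv , Adj-sym z′v ,
                     ¬zv , ¬z′u ∘ Adj-sym , z≢v , z′≢u ∘ sym) free

    _≺_ : Fin N → Fin N → Set
    u ≺ v = N̄ u ⊆′ N̄ v × (N̄ v ⊆′ N̄ u → toℕ u < toℕ v)

    ≺-irrefl : ∀ {u} → ¬ u ≺ u
    ≺-irrefl (_ , tie) = <-irrefl refl (tie λ _ z∈ → z∈)

    ≺-trans : ∀ {u v x} → u ≺ v → v ≺ x → u ≺ x
    ≺-trans (N̄u⊆N̄v , tie₁) (N̄v⊆N̄x , tie₂) =
      (λ z → N̄v⊆N̄x z ∘ N̄u⊆N̄v z) ,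
      λ N̄x⊆N̄u → <-trans (tie₁ λ z → N̄x⊆N̄u z ∘ N̄v⊆N̄x z) (tie₂ λ z → N̄u⊆N̄v z ∘ N̄x⊆N̄u z)

    ≺-connex-ordered : ∀ {u v} → Y u → Y v → Adj G u v → toℕ u < toℕ v → u ≺ v ⊎ v ≺ u
    ≺-connex-ordered {u} {v} Yu Yv uv u<v with N̄⊆N̄? u v
    ... | yes N̄u⊆N̄v = inj₁ (N̄u⊆N̄v , λ _ → u<v)
    ... | no  N̄u⊈N̄v =
      inj₂ (fromInj₂ (λ N̄u⊆N̄v → contradiction N̄u⊆N̄v N̄u⊈N̄v) (nested Yu Yv uv) ,
            λ N̄u⊆N̄v → contradiction N̄u⊆N̄v N̄u⊈N̄v)

    ≺-connex : ∀ {u v} → Y u → Y v → Adj G u v → u ≺ v ⊎ v ≺ u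
    ≺-connex {u} {v} Yu Yv uv with <-cmp (toℕ u) (toℕ v)
    ... | tri< u<v _ _ = ≺-connex-ordered Yu Yv uv u<v
    ... | tri≈ _ u≡v _ = contradiction (toℕ-injective u≡v) (Adj⇒≢ uv)
    ... | tri> _ _ v<u = swap (≺-connex-ordered Yv Yu (Adj-sym uv) v<u)

    Above : Fin N → VSet G
    Above v u = Y v × Y u × v ≺ u

    above? : ∀ v → Decidable (Above v)
    above? v u = Y? v ×-dec Y? u ×-dec (N̄⊆N̄? v u ×-dec (N̄⊆N̄? u v →-dec toℕ v <? toℕ u))

    above-trans : ∀ {v u x} → Above v u → Above u x → Above v x
    above-trans (Yv , _ , v≺u) (_ , Yx , u≺x) = Yv , Yx , ≺-trans v≺u u≺x

    above-adjacent : ∀ {v u} → Above v u → Adj G v u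
    above-adjacent (Yv , _ , v≺u@(N̄v⊆N̄u , _)) with N̄v⊆N̄u _ (Yv , inj₁ refl)
    ... | _ , inj₁ refl = contradiction v≺u ≺-irrefl
    ... | _ , inj₂ vu   = vu

    above-pairwise-adjacent : ∀ {v u u′} → Above v u → Above v u′ → u ≢ u′ → Adj G u u′
    above-pairwise-adjacent (_ , _ , N̄v⊆N̄u , _) u′-above@(_ , Yu′ , _) u≢u′
      with N̄v⊆N̄u _ (Yu′ , inj₂ (Adj-sym (above-adjacent u′-above)))
    ... | _ , inj₁ u′≡u = contradiction (sym u′≡u) u≢u′
    ... | _ , inj₂ u′u  = Adj-sym u′u

    rank : Fin N → ℕ
    rank v = ∣ subset (above? v) ∣

    rank-< : ∀ {v u} → Above v u → rank u < rank v
    rank-< {v} {u} u-above = p⊂q⇒∣p∣<∣q∣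
      ( ∈-subset⁺ (above? v) ∘ above-trans u-above ∘ ∈-subset⁻ (above? u)
      , u , ∈-subset⁺ (above? v) u-above , ≺-irrefl ∘ proj₂ ∘ proj₂ ∘ ∈-subset⁻ (above? u))

    rank-clique : ∀ v → HasClique G (suc (rank v))
    rank-clique v = vertex , pairwise-adjacent
      where
      above : Subset N
      above = subset (above? v)

      vertex : Fin (suc (rank v)) → Fin N
      vertex zero    = v
      vertex (suc i) = enumerate above i

      is-above : ∀ i → Above v (enumerate above i)
      is-above i = ∈-subset⁻ (above? v) (enumerate-∈ above i)

      pairwise-adjacent : ∀ i j → i ≢ j → Adj G (vertex i) (vertex j)
      pairwise-adjacent zero    zero    i≢j = contradiction refl i≢j
      pairwise-adjacent zero    (suc j) _   = above-adjacent (is-above j)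
      pairwise-adjacent (suc i) zero    _   = Adj-sym (above-adjacent (is-above i))
      pairwise-adjacent (suc i) (suc j) i≢j =
        above-pairwise-adjacent (is-above i) (is-above j) (i≢j ∘ cong suc ∘ enumerate-injective above)

  trivially-perfect-colourable : ∀ {Y : VSet G} {w} → Decidable Y → ¬ HasInducedP₄orC₄ Y →
    ¬ HasClique G (suc w) → Colourable G Y w
  trivially-perfect-colourable {Y} {w} Y? free ¬ω = (λ v → fromℕ< (rank<w v)) , rank-proper
    where
    open TriviallyPerfect Y? free

    rank<w : ∀ v → rank v < w
    rank<w v = clique-size-bound ¬ω (rank-clique v)

    rank-proper : Proper Y (λ v → fromℕ< (rank<w v))
    rank-proper u v Yu Yv uv same with rank-eq ← fromℕ<-injective _ _ (rank<w u) (rank<w v) same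
      with ≺-connex Yu Yv uv
    ... | inj₁ u≺v = <-irrefl (sym rank-eq) (rank-< (Yu , Yv , u≺v))
    ... | inj₂ v≺u = <-irrefl rank-eq (rank-< (Yv , Yu , v≺u))

  clique-colourable : ∀ {K : VSet G} {w} → Decidable K → (∀ {u v} → K u → K v → u ≢ v → Adj G u v) →
    ¬ HasClique G (suc w) → Colourable G K w
  clique-colourable K? clique = trivially-perfect-colourable K? λ
    (a , _ , c , _ , Ka , _ , Kc , _ , _ , _ , _ , ¬ac , _ , a≢c , _) → ¬ac (clique Ka Kc a≢c)

⌊n/2⌋+⌊n/2⌋≤n : ∀ n → ⌊ n /2⌋ + ⌊ n /2⌋ ≤ n
⌊n/2⌋+⌊n/2⌋≤n n = ≤-trans (+-monoʳ-≤ ⌊ n /2⌋ (⌊n/2⌋≤⌈n/2⌉ n)) (≤-reflexive (⌊n/2⌋+⌈n/2⌉≡n n))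

n≤1+⌊n/2⌋+⌊n/2⌋ : ∀ n → n ≤ suc (⌊ n /2⌋ + ⌊ n /2⌋)
n≤1+⌊n/2⌋+⌊n/2⌋ n = begin
  n                       ≡⟨ sym (⌊n/2⌋+⌈n/2⌉≡n n) ⟩
  ⌊ n /2⌋ + ⌈ n /2⌉       ≤⟨ +-monoʳ-≤ ⌊ n /2⌋ (⌊n/2⌋-mono (n≤1+n (suc n))) ⟩
  ⌊ n /2⌋ + suc ⌊ n /2⌋   ≡⟨ +-suc ⌊ n /2⌋ ⌊ n /2⌋ ⟩
  suc (⌊ n /2⌋ + ⌊ n /2⌋) ∎
  where open ≤-Reasoning

x+x≡2*x : ∀ x → x + x ≡ 2 * x
x+x≡2*x x = cong (x +_) (sym (+-identityʳ x))

edge-bound : ∀ n {c w} → n < suc (⌊ n /2⌋ + c) → 1 ≤ w → n < 2 * (c + w)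
edge-bound n {c} {w} n<1+t+c 1≤w = begin-strict
  n                 ≤⟨ n≤t+c ⟩
  t + c             ≤⟨ +-monoˡ-≤ c t≤c ⟩
  c + c             <⟨ +-mono-< c<c+w c<c+w ⟩
  (c + w) + (c + w) ≡⟨ x+x≡2*x (c + w) ⟩
  2 * (c + w)       ∎
  where
  open ≤-Reasoning
  t : ℕ
  t = ⌊ n /2⌋
  n≤t+c : n ≤ t + c
  n≤t+c = s≤s⁻¹ n<1+t+c
  t≤c : t ≤ c
  t≤c = +-cancelˡ-≤ t t c (≤-trans (⌊n/2⌋+⌊n/2⌋≤n n) n≤t+c)
  c<c+w : c < c + w
  c<c+w = m<m+n c 1≤w

square-bound : ∀ n {c w} → ⌊ n /2⌋ < w + c → n < 2 * (c + w)
square-bound n {c} {w} t<w+c = begin-strict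
  n                 ≤⟨ n≤1+⌊n/2⌋+⌊n/2⌋ n ⟩
  suc (t + t)       <⟨ s≤s (+-monoʳ-< t (n<1+n t)) ⟩
  suc t + suc t     ≤⟨ +-mono-≤ t<c+w t<c+w ⟩
  (c + w) + (c + w) ≡⟨ x+x≡2*x (c + w) ⟩
  2 * (c + w)       ∎
  where
  open ≤-Reasoning
  t : ℕ
  t = ⌊ n /2⌋
  t<c+w : t < c + w
  t<c+w = subst (t <_) (+-comm w c) t<w+c

module FourHoleFree {N : ℕ} (G : Graph N) (no-hole : ¬ HasFourHole G) where

  Common : Fin N → Fin N → VSet G
  Common a b = Nbhd G a ∩ Nbhd G b

  common? : ∀ a b → Decidable (Common a b)
  common? a b = adj? G a ∩? adj? G b

  Private : Fin N → Fin N → VSet G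
  Private a b s = Adj G a s × ¬ Adj G b s × s ≢ b

  private-disjoint : ∀ {a b} → Disjoint G (Private a b) (Private b a)
  private-disjoint s (_ , ¬bs , _) (bs , _) = ¬bs bs

  private-anticomplete : ∀ {a b} → Adj G a b → Anticomplete G (Private a b) (Private b a)
  private-anticomplete {a} {b} ab s t (as , ¬bs , s≢b) (bt , ¬at , t≢a) st =
    no-hole (s , a , b , t , s≢b , t≢a ∘ sym , Adj-sym G as , ab , bt , Adj-sym G st , ¬bs ∘ Adj-sym G , ¬at)

  common-clique : ∀ {a e u v} → ¬ Adj G a e → a ≢ e → Common a e u → Common a e v → u ≢ v → Adj G u v
  common-clique {a} {e} {u} {v} ¬ae a≢e (au , eu) (av , ev) u≢v = decidable-stable (adj? G u v) λ ¬uv →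
    no-hole (a , u , e , v , a≢e , u≢v , au , Adj-sym G eu , ev , Adj-sym G av , ¬ae , ¬uv)

  private-large : ∀ {a b m t c} → ChiGreater G (Nbhd G a) m →
    Colourable G (Common a b) t → Colourable G (Private a b) c → m < suc (t + c)
  private-large {a} {b} χ>m colCommon colPrivate =
    chi-subadditive G χ>m cover ((_≟ᶠ b) ∪? common? a b)
      (colourable-∪ G (_≟ᶠ b) (colourable-singleton G b) colCommon) colPrivate
    where
    cover : Nbhd G a ⊆ ((_≡ b) ∪ Common a b) ∪ Private a b
    cover {s} as with s ≟ᶠ b | adj? G b s
    ... | yes s≡b | _      = inj₁ (inj₁ s≡b)
    ... | no  _   | yes bs = inj₁ (inj₂ (as , bs))
    ... | no  s≢b | no ¬bs = inj₂ (as , ¬bs , s≢b)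

  common-large : ∀ {a e t c w} {D : VSet G} → ¬ HasClique G (suc w) → ¬ Adj G a e → a ≢ e →
    D ⊆ Nbhd G a → ChiGreater G D t → Colourable G (D ∩ ∁ (Nbhd G e)) c → t < w + c
  common-large {a} {e} {D = D} ¬ω ¬ae a≢e D⊆Na χ>t colOutside =
    chi-subadditive G χ>t cover (common? a e)
      (clique-colourable G (common? a e) (common-clique ¬ae a≢e) ¬ω) colOutside
    where
    cover : D ⊆ Common a e ∪ (D ∩ ∁ (Nbhd G e))
    cover {s} Ds with adj? G e s
    ... | yes es  = inj₁ (D⊆Na Ds , es)
    ... | no  ¬es = inj₂ (Ds , ¬es)

  -- χ(A) > n/2 − w, stated without division or truncated subtraction.
  HalfLarge : ℕ → ℕ → VSet G → Set
  HalfLarge n w A = ∀ c → Colourable G A c → n < 2 * (c + w)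

  Separation : ℕ → ℕ → Set₁
  Separation n w = Σ (VSet G) λ A → Σ (VSet G) λ B →
    Disjoint G A B × Anticomplete G A B × HalfLarge n w A × HalfLarge n w B

  edge-separation : ∀ {a b n w} → ¬ HasClique G (suc w) → Adj G a b →
    ChiGreater G (Nbhd G a) n → ChiGreater G (Nbhd G b) n →
    Colourable G (Common a b) ⌊ n /2⌋ → Separation n w
  edge-separation {a} {b} {n} {w} ¬ω ab χa>n χb>n colCommon =
    Private a b , Private b a , private-disjoint , private-anticomplete ab ,
    (λ c colPrivate → edge-bound n (private-large χa>n colCommon colPrivate) 1≤w) ,
    (λ c colPrivate → edge-bound n (private-large χb>n colCommon′ colPrivate) 1≤w)
    where
    1≤w : 1 ≤ w
    1≤w = clique-size-bound G ¬ω (singleton-clique G a)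
    colCommon′ : Colourable G (Common b a) ⌊ n /2⌋
    colCommon′ = colourable-⊆ G (λ (bs , as) → as , bs) colCommon

  square-separation : ∀ {x₁ x₂ x₃ x₄ n w} → ¬ HasClique G (suc w) → Adj G x₂ x₃ →
    ¬ Adj G x₁ x₃ → ¬ Adj G x₂ x₄ → x₁ ≢ x₃ → x₂ ≢ x₄ →
    ChiGreater G (Common x₁ x₂) ⌊ n /2⌋ → ChiGreater G (Common x₃ x₄) ⌊ n /2⌋ → Separation n w
  square-separation {x₁} {x₂} {x₃} {x₄} {n} {w} ¬ω x₂x₃ ¬x₁x₃ ¬x₂x₄ x₁≢x₃ x₂≢x₄ χ₁₂ χ₃₄ =
    Common x₁ x₂ ∩ ∁ (Nbhd G x₃) , Common x₃ x₄ ∩ ∁ (Nbhd G x₂) ,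
    (λ s ((_ , x₂s) , _) (_ , ¬x₂s) → ¬x₂s x₂s) ,
    anticomplete ,
    (λ c col → square-bound n {c} {w} (common-large ¬ω ¬x₁x₃ x₁≢x₃ proj₁ χ₁₂ col)) ,
    (λ c col → square-bound n {c} {w} (common-large ¬ω (¬x₂x₄ ∘ Adj-sym G) (x₂≢x₄ ∘ sym) proj₂ χ₃₄ col))
    where
    anticomplete : Anticomplete G (Common x₁ x₂ ∩ ∁ (Nbhd G x₃)) (Common x₃ x₄ ∩ ∁ (Nbhd G x₂))
    anticomplete u v ((x₁u , x₂u) , ¬x₃u) ((x₃v , x₄v) , ¬x₂v) uv =
      no-hole (u , x₂ , x₃ , v , (λ { refl → ¬x₁x₃ x₁u }) , (λ { refl → ¬x₂x₄ (Adj-sym G x₄v) }) ,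
               Adj-sym G x₂u , x₂x₃ , x₃v , Adj-sym G uv , ¬x₃u ∘ Adj-sym G , ¬x₂v)

mainTheorem11 : (N : ℕ) (G : Graph N) → ¬ HasFourHole G →
    (n w : ℕ) → IsCliqueNumber G w →
    ChiGreater G (λ v → ChiGreater G (Nbhd G v) n) w →
    Σ (VSet G) λ A → Σ (VSet G) λ B →
      Disjoint G A B × Anticomplete G A B ×
      (∀ c → Colourable G A c → n < 2 * (c + w)) ×
      (∀ c → Colourable G B c → n < 2 * (c + w))
mainTheorem11 N G no-hole n w (_ , ¬ω) χX>w = separation X-has-P₄orC₄
  where
  open FourHoleFree G no-hole

  X : VSet G
  X v = ChiGreater G (Nbhd G v) n

  X? : Decidable X
  X? v = ¬? (colourable? G (adj? G v) n)

  X-has-P₄orC₄ : HasInducedP₄orC₄ G X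
  X-has-P₄orC₄ = decidable-stable (hasInducedP₄orC₄? G X?) λ free →
    χX>w (trivially-perfect-colourable G X? free ¬ω)

  separation : HasInducedP₄orC₄ G X → Separation n w
  separation (x₁ , x₂ , x₃ , x₄ , Xx₁ , Xx₂ , Xx₃ , Xx₄ , x₁x₂ , x₂x₃ , x₃x₄ , ¬x₁x₃ , ¬x₂x₄ , x₁≢x₃ , x₂≢x₄)
    with colourable? G (common? x₁ x₂) ⌊ n /2⌋ | colourable? G (common? x₃ x₄) ⌊ n /2⌋
  ... | yes col₁₂ | _         = edge-separation ¬ω x₁x₂ Xx₁ Xx₂ col₁₂
  ... | no  _     | yes col₃₄ = edge-separation ¬ω x₃x₄ Xx₃ Xx₄ col₃₄
  ... | no  χ₁₂   | no  χ₃₄   = square-separation ¬ω x₂x₃ ¬x₁x₃ ¬x₂x₄ x₁≢x₃ x₂≢x₄ χ₁₂ χ₃₄
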